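{- Let $\gamma,\delta$ be columns. Let $\gamma'=\gamma\cdot\delta$ (the action of the word $\gamma$ on the column $\delta$) and let $\delta'=(\gamma\cup\delta)\setminus(\gamma\cdot\delta)$, where union and difference are taken as multisets. Then: (i) $\gamma\subseteq\gamma'$; (ii) $\gamma'\leq\gamma$; (iii) $\gamma'=\gamma$ iff $\delta'=\delta$ iff $\gamma\leq\delta$; (iv) $\gamma'\leq\delta'$; (v) $\gamma\delta\equiv_{plax}\gamma'\delta'$ as words (with $\delta'$ the empty word if it is the empty column).
   Context: $A$ is a finite totally ordered alphabet. A column is a subset of $A$, identified with the strictly decreasing word of its elements. For a column $\gamma$ and a letter $x$: if $x>y$ for all $y\in\gamma$, $x\cdot\gamma=\gamma\cup\{x\}$; otherwise with $y$ the smallest element of $\gamma$ with $y\geq x$, $x\cdot\gamma=(\gamma\setminus\{y\})\cup\{x\}$; this extends to a left action of $A^*$ on columns by $(uv)\cdot\gamma=u\cdot(v\cdot\gamma)$. Order on columns: $\gamma_1\leq\gamma_2$ iff $|\gamma_2|\leq|\gamma_1|$ and for each $i\leq|\gamma_2|$ the $i$-th smallest element of $\gamma_1$ is $\leq$ the $i$-th smallest element of $\gamma_2$ (the empty column is the maximum). $\equiv_{plax}$ is the plactic congruence: $u\equiv_{plax}v$ iff $u$ and $v$ have the same Schensted tableau $P(u)=P(v)$. -}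

module Defs where

open import Data.Nat using (ℕ)
open import Data.Fin using (Fin; _≤_; _<_; _≤?_; _<?_; _≟_)
open import Data.List using (List; []; _∷_; reverse; filter; last; merge)
open import Data.Maybe using (Maybe; just; nothing)
open import Data.Product using (_×_; _,_)
open import Data.List.Relation.Unary.Linked using (Linked)
open import Relation.Nullary using (yes; no)
open import Relation.Binary.PropositionalEquality using (_≡_)

module _ {n : ℕ} where

  -- A column is a subset of A identified with the strictly decreasing word
  -- of its elements.
  IsColumn : List (Fin n) → Set
  IsColumn = Linked (λ x y → y < x)

  -- x · γ : if x > every element of γ, add x; otherwise replace the smallest
  -- y ∈ γ with y ≥ x by x.  Since γ is stored decreasingly, the elements
  -- ≥ x form a prefix and the smallest of them is the last of that prefix;
  -- replacing it in place keeps the word decreasing.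
  replace : Fin n → Fin n → List (Fin n) → List (Fin n)
  replace y x [] = []
  replace y x (z ∷ zs) with z ≟ y
  ... | yes _ = x ∷ zs
  ... | no _  = z ∷ replace y x zs

  actL : Fin n → List (Fin n) → List (Fin n)
  actL x γ with last (filter (x ≤?_) γ)
  ... | nothing = x ∷ γ
  ... | just y  = replace y x γ

  actW : List (Fin n) → List (Fin n) → List (Fin n)
  actW []      γ = γ
  actW (x ∷ u) γ = actL x (actW u γ)

  msUnion : List (Fin n) → List (Fin n) → List (Fin n)
  msUnion = merge (λ x y → y ≤? x)

  removeOne : Fin n → List (Fin n) → List (Fin n)
  removeOne x [] = []
  removeOne x (z ∷ zs) with z ≟ x
  ... | yes _ = zs
  ... | no _  = z ∷ removeOne x zs

  msDiff : List (Fin n) → List (Fin n) → List (Fin n)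
  msDiff xs []       = xs
  msDiff xs (y ∷ ys) = msDiff (removeOne y xs) ys

  -- Pointwise comparison of increasing lists, second one a "prefix-length"
  -- of the first: encodes |c2| ≤ |c1| and i-th smallest of c1 ≤ i-th
  -- smallest of c2 for every i ≤ |c2|.
  data AscLe : List (Fin n) → List (Fin n) → Set where
    nil  : ∀ {xs} → AscLe xs []
    cons : ∀ {x y xs ys} → x ≤ y → AscLe xs ys → AscLe (x ∷ xs) (y ∷ ys)

  _≤ᶜ_ : List (Fin n) → List (Fin n) → Set
  c₁ ≤ᶜ c₂ = AscLe (reverse c₁) (reverse c₂)

  rowIns : Fin n → List (Fin n) → Maybe (Fin n) × List (Fin n)
  rowIns x [] = nothing , x ∷ []
  rowIns x (y ∷ ys) with x <? y
  ... | yes _ = just y , x ∷ ys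
  ... | no _  with rowIns x ys
  ...   | b , r = b , y ∷ r

  -- Insertion into a tableau given as its list of rows (top row first).
  tabIns : Fin n → List (List (Fin n)) → List (List (Fin n))
  tabIns x [] = (x ∷ []) ∷ []
  tabIns x (r ∷ rs) with rowIns x r
  ... | nothing , r' = r' ∷ rs
  ... | just y  , r' = r' ∷ tabIns y rs

  P-from : List (List (Fin n)) → List (Fin n) → List (List (Fin n))
  P-from T []      = T
  P-from T (x ∷ u) = P-from (tabIns x T) u

  P : List (Fin n) → List (List (Fin n))
  P = P-from []

  _≡plax_ : List (Fin n) → List (Fin n) → Set
  u ≡plax v = P u ≡ P v

-- Work with the increasing readings G = reverse γ and D = reverse δ.  A single
-- merge-like pass, columns G D, scans D upwards: a letter d lying below the
-- current letter g of G goes to the left column, otherwise g and d form a row.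
-- Read row by row this pair of columns is the Schensted tableau of γδ (inserting
-- the letters of δ one at a time preserves this shape), its left column is the
-- increasing reading of γ·δ (adding a new largest letter g to G acts by g on the
-- left column), and its right column is what remains of the multiset union.  Properties (i)–(iv) are
-- structural facts about columns, and (v) holds because columns fixes any pair
-- G ≤ D, in particular the pair it produced itself.
module Submission where

open import Defs
open import Data.Nat using (ℕ)
import Data.Nat.Properties as ℕ
open import Data.Fin using (Fin; _≤_; _<_; _≤?_; _<?_; _≟_)
import Data.Fin.Properties as Fin
open import Data.Empty using (⊥-elim)
open import Data.List using (List; []; _∷_; _++_; _∷ʳ_; _ʳ++_; reverse; filter; last; [_])
import Data.List.Properties as List
open import Data.List.Membership.Propositional using (_∈_)
open import Data.List.Relation.Binary.Equality.Propositional using (≋⇒≡)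
open import Data.List.Relation.Binary.Permutation.Propositional
  using (_↭_; prep; swap; ↭-refl; ↭-sym; ↭-trans; ↭-reflexive; ↭⇒↭ₛ; module PermutationReasoning)
import Data.List.Relation.Binary.Permutation.Propositional.Properties as Perm
open import Data.List.Relation.Binary.Subset.Propositional using (_⊆_)
open import Data.List.Relation.Unary.All as All using (All; []; _∷_)
import Data.List.Relation.Unary.All.Properties as AllP
open import Data.List.Relation.Unary.AllPairs as AllPairs using (AllPairs; []; _∷_)
import Data.List.Relation.Unary.AllPairs.Properties as AllPairsP
open import Data.List.Relation.Unary.Any as Any using (Any; here; there)
import Data.List.Relation.Unary.Any.Properties as AnyP
import Data.List.Relation.Unary.Linked.Properties as LinkedP
import Data.List.Relation.Unary.Sorted.TotalOrder.Properties as Sorted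
open import Data.Maybe using (Maybe; just; nothing)
open import Data.Product using (_×_; _,_; proj₁; proj₂; map; map₁; map₂)
open import Function.Base using (flip; _∘_)
open import Function.Bundles using (_⇔_; mk⇔)
open import Function.Construct.Composition using (_⇔-∘_)
open import Function.Construct.Symmetry using (⇔-sym)
open import Relation.Binary.Bundles using (DecTotalOrder)
open import Relation.Binary.Core using (Rel)
import Relation.Binary.Construct.Flip.EqAndOrd as Flip
open import Relation.Binary.PropositionalEquality
  using (_≡_; _≢_; refl; sym; trans; cong; cong₂; subst; subst₂; module ≡-Reasoning)
open import Relation.Nullary using (¬_; yes; no)
open import Relation.Unary using (Pred; Decidable)

All-reverse⁺ : ∀ {a p} {A : Set a} {P : Pred A p} {xs} → All P xs → All P (reverse xs)
All-reverse⁺ {xs = xs} = Perm.All-resp-↭ (↭-sym (Perm.↭-reverse xs))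

module _ {a ℓ} {A : Set a} {R : Rel A ℓ} where

  AllPairs-reverse⁺ : ∀ {xs} → AllPairs (flip R) xs → AllPairs R (reverse xs)
  AllPairs-reverse⁺ {[]} [] = []
  AllPairs-reverse⁺ {x ∷ xs} (x>xs ∷ pxs) =
    subst (AllPairs R) (sym (List.unfold-reverse x xs))
      (AllPairsP.++⁺ (AllPairs-reverse⁺ pxs) ([] ∷ [])
        (All.map (_∷ []) (All-reverse⁺ x>xs)))

  AllPairs-ʳ++⁻ʳ : ∀ xs {ys} → AllPairs R (xs ʳ++ ys) → AllPairs R ys
  AllPairs-ʳ++⁻ʳ []       p = p
  AllPairs-ʳ++⁻ʳ (x ∷ xs) p with _ ∷ q ← AllPairs-ʳ++⁻ʳ xs p = q

AllPairs-reverse⁻ : ∀ {a ℓ} {A : Set a} {R : Rel A ℓ} {xs} → AllPairs R (reverse xs) → AllPairs (flip R) xs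
AllPairs-reverse⁻ {R = R} {xs} p =
  subst (AllPairs (flip R)) (List.reverse-involutive xs) (AllPairs-reverse⁺ {R = flip R} p)

filter-≢[] : ∀ {a p} {A : Set a} {P : Pred A p} (P? : Decidable P) {xs} →
             Any P xs → filter P? xs ≢ []
filter-≢[] P? {x ∷ _} x∈P with P? x
... | yes _ = λ ()
filter-≢[] P? (here px)   | no ¬px = ⊥-elim (¬px px)
filter-≢[] P? (there pxs) | no _   = filter-≢[] P? pxs

≡⇔reverse≡ : ∀ {a} {A : Set a} {xs ys zs : List A} →
             reverse xs ≡ ys → (xs ≡ zs ⇔ ys ≡ reverse zs)
≡⇔reverse≡ refl = mk⇔ (cong reverse) List.reverse-injective

module _ {n : ℕ} where

  Increasing Decreasing : List (Fin n) → Set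
  Increasing = AllPairs _<_
  Decreasing = AllPairs (flip _<_)

  column⇒decreasing : ∀ {γ} → IsColumn γ → Decreasing γ
  column⇒decreasing = LinkedP.Linked⇒AllPairs (λ y<x z<y → Fin.<-trans z<y y<x)

  AscLe-refl : ∀ (xs : List (Fin n)) → AscLe xs xs
  AscLe-refl []       = nil
  AscLe-refl (x ∷ xs) = cons Fin.≤-refl (AscLe-refl xs)

  AscLe-tailʳ : ∀ {xs y ys} → Increasing xs → AscLe xs (y ∷ ys) → AscLe xs ys
  AscLe-tailʳ {ys = []} _ _ = nil
  AscLe-tailʳ {ys = _ ∷ _} ((x<x′ ∷ _) ∷ incxs) (cons _ (cons x′≤y′ xs≤ys)) =
    cons (ℕ.<⇒≤ (ℕ.<-≤-trans x<x′ x′≤y′)) (AscLe-tailʳ incxs (cons x′≤y′ xs≤ys))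

  AscLe-∷ˡ : ∀ {x xs ys} → Increasing xs → All (x ≤_) ys → AscLe xs ys → AscLe (x ∷ xs) ys
  AscLe-∷ˡ _     []          _     = nil
  AscLe-∷ˡ incxs (x≤y ∷ _) xs≤ys = cons x≤y (AscLe-tailʳ incxs xs≤ys)

  columns : List (Fin n) → List (Fin n) → List (Fin n) × List (Fin n)
  columns []      D       = D , []
  columns (g ∷ G) []      = g ∷ G , []
  columns (g ∷ G) (d ∷ D) with d <? g
  ... | yes _ = map₁ (d ∷_) (columns (g ∷ G) D)
  ... | no  _ = map (g ∷_) (d ∷_) (columns G D)

  leftCol rightCol : List (Fin n) → List (Fin n) → List (Fin n)
  leftCol  G D = proj₁ (columns G D)
  rightCol G D = proj₂ (columns G D)

  columns-[]ʳ : ∀ G → columns G [] ≡ (G , [])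
  columns-[]ʳ []      = refl
  columns-[]ʳ (_ ∷ _) = refl

  columns-≮ : ∀ {g d} G D → ¬ d < g → columns (g ∷ G) (d ∷ D) ≡ map (g ∷_) (d ∷_) (columns G D)
  columns-≮ {g} {d} G D d≮g with d <? g
  ... | yes d<g = ⊥-elim (d≮g d<g)
  ... | no _    = refl

  All-leftCol : ∀ {p} {P : Pred (Fin n) p} G D → All P G → All P D → All P (leftCol G D)
  All-leftCol []      D       _            pD         = pD
  All-leftCol (g ∷ G) []      pG           _          = pG
  All-leftCol (g ∷ G) (d ∷ D) pG@(pg ∷ pG′) (pd ∷ pD′) with d <? g
  ... | yes _ = pd ∷ All-leftCol (g ∷ G) D pG pD′
  ... | no  _ = pg ∷ All-leftCol G D pG′ pD′

  All-rightCol : ∀ {p} {P : Pred (Fin n) p} G D → All P D → All P (rightCol G D)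
  All-rightCol []      D       _          = []
  All-rightCol (g ∷ G) []      _          = []
  All-rightCol (g ∷ G) (d ∷ D) (pd ∷ pD′) with d <? g
  ... | yes _ = All-rightCol (g ∷ G) D pD′
  ... | no  _ = pd ∷ All-rightCol G D pD′

  leftCol-increasing : ∀ G D → Increasing G → Increasing D → Increasing (leftCol G D)
  leftCol-increasing []      D       _                   incD           = incD
  leftCol-increasing (g ∷ G) []      incG                _              = incG
  leftCol-increasing (g ∷ G) (d ∷ D) incG@(g<G ∷ incG′) (d<D ∷ incD′) with d <? g
  ... | yes d<g = All-leftCol (g ∷ G) D (d<g ∷ All.map (Fin.<-trans d<g) g<G) d<D
                ∷ leftCol-increasing (g ∷ G) D incG incD′
  ... | no  d≮g = All-leftCol G D g<G (All.map (ℕ.≤-<-trans (ℕ.≮⇒≥ d≮g)) d<D)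
                ∷ leftCol-increasing G D incG′ incD′

  rightCol-increasing : ∀ G D → Increasing D → Increasing (rightCol G D)
  rightCol-increasing []      D       _              = []
  rightCol-increasing (g ∷ G) []      _              = []
  rightCol-increasing (g ∷ G) (d ∷ D) (d<D ∷ incD′) with d <? g
  ... | yes _ = rightCol-increasing (g ∷ G) D incD′
  ... | no  _ = All-rightCol G D d<D ∷ rightCol-increasing G D incD′

  leftCol≤rightCol : ∀ G D → Increasing G → Increasing D → AscLe (leftCol G D) (rightCol G D)
  leftCol≤rightCol []      D       _                 _              = nil
  leftCol≤rightCol (g ∷ G) []      _                 _              = nil
  leftCol≤rightCol (g ∷ G) (d ∷ D) incG@(_ ∷ incG′) (d<D ∷ incD′) with d <? g
  ... | yes _   = AscLe-∷ˡ (leftCol-increasing (g ∷ G) D incG incD′)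
                    (All.map ℕ.<⇒≤ (All-rightCol (g ∷ G) D d<D))
                    (leftCol≤rightCol (g ∷ G) D incG incD′)
  ... | no  d≮g = cons (ℕ.≮⇒≥ d≮g) (leftCol≤rightCol G D incG′ incD′)

  leftCol≤left : ∀ G D → Increasing G → Increasing D → AscLe (leftCol G D) G
  leftCol≤left []      D       _                   _              = nil
  leftCol≤left (g ∷ G) []      _                   _              = AscLe-refl (g ∷ G)
  leftCol≤left (g ∷ G) (d ∷ D) incG@(g<G ∷ incG′) (d<D ∷ incD′) with d <? g
  ... | yes d<g = AscLe-∷ˡ (leftCol-increasing (g ∷ G) D incG incD′)
                    (All.map ℕ.<⇒≤ (d<g ∷ All.map (Fin.<-trans d<g) g<G))
                    (leftCol≤left (g ∷ G) D incG incD′)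
  ... | no  _   = cons Fin.≤-refl (leftCol≤left G D incG′ incD′)

  ⊆-leftCol : ∀ G D → G ⊆ leftCol G D
  ⊆-leftCol (g ∷ G) []      x∈G = x∈G
  ⊆-leftCol (g ∷ G) (d ∷ D) x∈G with d <? g
  ... | yes _ = there (⊆-leftCol (g ∷ G) D x∈G)
  ⊆-leftCol (g ∷ G) (d ∷ D) (here x≡g)  | no _ = here x≡g
  ⊆-leftCol (g ∷ G) (d ∷ D) (there x∈G) | no _ = there (⊆-leftCol G D x∈G)

  columns-fixed : ∀ G D → AscLe G D → columns G D ≡ (G , D)
  columns-fixed []      _       nil              = refl
  columns-fixed (g ∷ G) []      _                = refl
  columns-fixed (g ∷ G) (d ∷ D) (cons g≤d G≤D) with d <? g
  ... | yes d<g = ⊥-elim (ℕ.<⇒≱ d<g g≤d)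
  ... | no  _   = cong (map (g ∷_) (d ∷_)) (columns-fixed G D G≤D)

  leftCol≡⇒rightCol≡ : ∀ G D → leftCol G D ≡ G → rightCol G D ≡ D
  leftCol≡⇒rightCol≡ []      D       eq = sym eq
  leftCol≡⇒rightCol≡ (g ∷ G) []      _  = refl
  leftCol≡⇒rightCol≡ (g ∷ G) (d ∷ D) eq with d <? g
  ... | yes d<g = ⊥-elim (Fin.<-irrefl (List.∷-injectiveˡ eq) d<g)
  ... | no  _   = cong (d ∷_) (leftCol≡⇒rightCol≡ G D (List.∷-injectiveʳ eq))

  rightCol≡⇒leftCol≡ : ∀ G D → Increasing D → rightCol G D ≡ D → leftCol G D ≡ G
  rightCol≡⇒leftCol≡ []      []      _              _  = refl
  rightCol≡⇒leftCol≡ (g ∷ G) []      _              _  = refl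
  rightCol≡⇒leftCol≡ (g ∷ G) (d ∷ D) (d<D ∷ incD′) eq with d <? g
  ... | yes _ = ⊥-elim (Fin.<-irrefl refl (All.head (subst (All (d <_)) eq (All-rightCol (g ∷ G) D d<D))))
  ... | no  _ = cong (g ∷_) (rightCol≡⇒leftCol≡ G D incD′ (List.∷-injectiveʳ eq))

  leftCol≡⇔rightCol≡ : ∀ G D → Increasing D → (leftCol G D ≡ G ⇔ rightCol G D ≡ D)
  leftCol≡⇔rightCol≡ G D incD = mk⇔ (leftCol≡⇒rightCol≡ G D) (rightCol≡⇒leftCol≡ G D incD)

  rightCol≡⇔AscLe : ∀ G D → Increasing G → Increasing D → (rightCol G D ≡ D ⇔ AscLe G D)
  rightCol≡⇔AscLe G D incG incD = mk⇔
    (λ eq → subst₂ AscLe (rightCol≡⇒leftCol≡ G D incD eq) eq (leftCol≤rightCol G D incG incD))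
    (λ G≤D → cong proj₂ (columns-fixed G D G≤D))

  columns-↭ : ∀ G D → G ++ D ↭ leftCol G D ++ rightCol G D
  columns-↭ []      D       = ↭-reflexive (sym (List.++-identityʳ D))
  columns-↭ (g ∷ G) []      = ↭-refl
  columns-↭ (g ∷ G) (d ∷ D) with d <? g
  ... | yes _ = begin
    g ∷ G ++ d ∷ D                            ↭⟨ Perm.shift d (g ∷ G) D ⟩
    d ∷ (g ∷ G ++ D)                          ↭⟨ prep d (columns-↭ (g ∷ G) D) ⟩
    d ∷ (leftCol (g ∷ G) D ++ rightCol (g ∷ G) D) ∎
    where open PermutationReasoning
  ... | no  _ = begin
    g ∷ (G ++ d ∷ D)                          ↭⟨ prep g (Perm.shift d G D) ⟩
    g ∷ d ∷ (G ++ D)                          ↭⟨ prep g (prep d (columns-↭ G D)) ⟩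
    g ∷ d ∷ (leftCol G D ++ rightCol G D)     ↭⟨ prep g (Perm.shift d (leftCol G D) (rightCol G D)) ⟨
    g ∷ (leftCol G D ++ d ∷ rightCol G D)     ∎
    where open PermutationReasoning

  actAsc : Fin n → List (Fin n) → List (Fin n)
  actAsc x []       = [ x ]
  actAsc x (y ∷ ys) with x ≤? y
  ... | yes _ = x ∷ ys
  ... | no  _ = y ∷ actAsc x ys

  actAsc-≤ : ∀ {x y} ys → x ≤ y → actAsc x (y ∷ ys) ≡ x ∷ ys
  actAsc-≤ {x} {y} _ x≤y with x ≤? y
  ... | yes _   = refl
  ... | no  x≰y = ⊥-elim (x≰y x≤y)

  actAsc-≰ : ∀ {x y} ys → ¬ x ≤ y → actAsc x (y ∷ ys) ≡ y ∷ actAsc x ys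
  actAsc-≰ {x} {y} _ x≰y with x ≤? y
  ... | yes x≤y = ⊥-elim (x≰y x≤y)
  ... | no  _   = refl

  actAsc-above : ∀ {x} L → All (_< x) L → actAsc x L ≡ L ∷ʳ x
  actAsc-above []      []           = refl
  actAsc-above (l ∷ L) (l<x ∷ L<x) =
    trans (actAsc-≰ L (ℕ.<⇒≱ l<x)) (cong (l ∷_) (actAsc-above L L<x))

  actAsc-∷ʳ-≤ : ∀ {x c} L → All (_< x) L → x ≤ c → actAsc x (L ∷ʳ c) ≡ L ∷ʳ x
  actAsc-∷ʳ-≤ []      []           x≤c = actAsc-≤ [] x≤c
  actAsc-∷ʳ-≤ (l ∷ L) (l<x ∷ L<x) x≤c =
    trans (actAsc-≰ (L ∷ʳ _) (ℕ.<⇒≱ l<x)) (cong (l ∷_) (actAsc-∷ʳ-≤ L L<x x≤c))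

  actAsc-∷ʳ : ∀ {x} c L → Any (x ≤_) L → actAsc x (L ∷ʳ c) ≡ actAsc x L ∷ʳ c
  actAsc-∷ʳ {x} c (l ∷ L) x≤L with x ≤? l
  ... | yes _ = refl
  actAsc-∷ʳ c (l ∷ L) (here x≤l)  | no x≰l = ⊥-elim (x≰l x≤l)
  actAsc-∷ʳ c (l ∷ L) (there x≤L) | no _   = cong (l ∷_) (actAsc-∷ʳ c L x≤L)

  leftCol-∷ʳ : ∀ {g} G D → All (_< g) G → leftCol (G ∷ʳ g) D ≡ actAsc g (leftCol G D)
  leftCol-∷ʳ []       []      [] = refl
  leftCol-∷ʳ {g} []   (d ∷ D) [] with d <? g
  ... | yes d<g = trans (cong (d ∷_) (leftCol-∷ʳ [] D [])) (sym (actAsc-≰ D (ℕ.<⇒≱ d<g)))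
  ... | no  d≮g = sym (actAsc-≤ D (ℕ.≮⇒≥ d≮g))
  leftCol-∷ʳ (g′ ∷ G) []      G<g = sym (actAsc-above (g′ ∷ G) G<g)
  leftCol-∷ʳ {g} (g′ ∷ G) (d ∷ D) (g′<g ∷ G<g) with d <? g′
  ... | yes d<g′ = trans (cong (d ∷_) (leftCol-∷ʳ (g′ ∷ G) D (g′<g ∷ G<g)))
                         (sym (actAsc-≰ _ (ℕ.<⇒≱ (Fin.<-trans d<g′ g′<g))))
  ... | no  _    = trans (cong (g′ ∷_) (leftCol-∷ʳ G D G<g)) (sym (actAsc-≰ _ (ℕ.<⇒≱ g′<g)))

  replace-hit : ∀ (y x : Fin n) zs → replace y x (y ∷ zs) ≡ x ∷ zs
  replace-hit y x zs with y ≟ y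
  ... | yes _   = refl
  ... | no  y≢y = ⊥-elim (y≢y refl)

  replace-miss : ∀ {c y : Fin n} x zs → c ≢ y → replace y x (c ∷ zs) ≡ c ∷ replace y x zs
  replace-miss {c} {y} x zs c≢y with c ≟ y
  ... | yes c≡y = ⊥-elim (c≢y c≡y)
  ... | no  _   = refl

  actLast : Maybe (Fin n) → Fin n → List (Fin n) → List (Fin n)
  actLast nothing  x γ = x ∷ γ
  actLast (just y) x γ = replace y x γ

  actL≡actLast : ∀ x γ → actL x γ ≡ actLast (last (filter (x ≤?_) γ)) x γ
  actL≡actLast x γ with last (filter (x ≤?_) γ)
  ... | nothing = refl
  ... | just _  = refl

  actLast-∷ : ∀ {x c} C F → F ≢ [] → All (_< c) F →
              actLast (last (c ∷ F)) x (c ∷ C) ≡ c ∷ actLast (last F) x C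
  actLast-∷     C []           F≢[] _           = ⊥-elim (F≢[] refl)
  actLast-∷ {x} C (f ∷ [])     _    (f<c ∷ []) = replace-miss x C (λ c≡f → Fin.<-irrefl (sym c≡f) f<c)
  actLast-∷     C (_ ∷ f ∷ F) _    (_ ∷ F<c)  = actLast-∷ C (f ∷ F) (λ ()) F<c

  actL-above : ∀ {x} C → All (_< x) C → actL x C ≡ x ∷ C
  actL-above {x} C C<x = trans (actL≡actLast x C)
    (cong (λ F → actLast (last F) x C) (List.filter-none (x ≤?_) (All.map ℕ.<⇒≱ C<x)))

  actL-bumpHead : ∀ {x c} C → x ≤ c → All (_< x) C → actL x (c ∷ C) ≡ x ∷ C
  actL-bumpHead {x} {c} C x≤c C<x = begin
    actL x (c ∷ C)                                    ≡⟨ actL≡actLast x (c ∷ C) ⟩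
    actLast (last (filter (x ≤?_) (c ∷ C))) x (c ∷ C) ≡⟨ cong (λ F → actLast (last F) x (c ∷ C))
                                                            (List.filter-accept (x ≤?_) x≤c) ⟩
    actLast (last (c ∷ filter (x ≤?_) C)) x (c ∷ C)   ≡⟨ cong (λ F → actLast (last (c ∷ F)) x (c ∷ C))
                                                            (List.filter-none (x ≤?_) (All.map ℕ.<⇒≱ C<x)) ⟩
    replace c x (c ∷ C)                               ≡⟨ replace-hit c x C ⟩
    x ∷ C                                             ∎
    where open ≡-Reasoning

  actL-∷ : ∀ {x c} C → x ≤ c → All (_< c) C → Any (x ≤_) C → actL x (c ∷ C) ≡ c ∷ actL x C
  actL-∷ {x} {c} C x≤c C<c x≤C = begin
    actL x (c ∷ C)                                    ≡⟨ actL≡actLast x (c ∷ C) ⟩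
    actLast (last (filter (x ≤?_) (c ∷ C))) x (c ∷ C) ≡⟨ cong (λ F → actLast (last F) x (c ∷ C))
                                                            (List.filter-accept (x ≤?_) x≤c) ⟩
    actLast (last (c ∷ filter (x ≤?_) C)) x (c ∷ C)   ≡⟨ actLast-∷ C (filter (x ≤?_) C)
                                                            (filter-≢[] (x ≤?_) x≤C) (AllP.filter⁺ (x ≤?_) C<c) ⟩
    c ∷ actLast (last (filter (x ≤?_) C)) x C         ≡⟨ cong (c ∷_) (actL≡actLast x C) ⟨
    c ∷ actL x C                                      ∎
    where open ≡-Reasoning

  reverse-actL : ∀ x C → Decreasing C → reverse (actL x C) ≡ actAsc x (reverse C)
  reverse-actL x []      []              = refl
  reverse-actL x (c ∷ C) (C<c ∷ decC) with x ≤? c | Any.any? (x ≤?_) C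
  ... | no x≰c | _ = begin
    reverse (actL x (c ∷ C))   ≡⟨ cong reverse (actL-above (c ∷ C) cC<x) ⟩
    reverse (x ∷ c ∷ C)        ≡⟨ List.unfold-reverse x (c ∷ C) ⟩
    reverse (c ∷ C) ∷ʳ x       ≡⟨ actAsc-above (reverse (c ∷ C)) (All-reverse⁺ cC<x) ⟨
    actAsc x (reverse (c ∷ C)) ∎
    where
    open ≡-Reasoning
    c<x = ℕ.≰⇒> x≰c
    cC<x = c<x ∷ All.map (λ y<c → Fin.<-trans y<c c<x) C<c
  ... | yes x≤c | no x≰C = begin
    reverse (actL x (c ∷ C))   ≡⟨ cong reverse (actL-bumpHead C x≤c C<x) ⟩
    reverse (x ∷ C)            ≡⟨ List.unfold-reverse x C ⟩
    reverse C ∷ʳ x             ≡⟨ actAsc-∷ʳ-≤ (reverse C) (All-reverse⁺ C<x) x≤c ⟨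
    actAsc x (reverse C ∷ʳ c)  ≡⟨ cong (actAsc x) (List.unfold-reverse c C) ⟨
    actAsc x (reverse (c ∷ C)) ∎
    where
    open ≡-Reasoning
    C<x = All.map ℕ.≰⇒> (AllP.¬Any⇒All¬ C x≰C)
  ... | yes x≤c | yes x≤C = begin
    reverse (actL x (c ∷ C))      ≡⟨ cong reverse (actL-∷ C x≤c C<c x≤C) ⟩
    reverse (c ∷ actL x C)        ≡⟨ List.unfold-reverse c (actL x C) ⟩
    reverse (actL x C) ∷ʳ c       ≡⟨ cong (_∷ʳ c) (reverse-actL x C decC) ⟩
    actAsc x (reverse C) ∷ʳ c     ≡⟨ actAsc-∷ʳ c (reverse C) (AnyP.reverse⁺ x≤C) ⟨
    actAsc x (reverse C ∷ʳ c)     ≡⟨ cong (actAsc x) (List.unfold-reverse c C) ⟨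
    actAsc x (reverse (c ∷ C))    ∎
    where open ≡-Reasoning

  reverse-actW : ∀ γ δ → Decreasing γ → Decreasing δ →
                 reverse (actW γ δ) ≡ leftCol (reverse γ) (reverse δ)
  reverse-actW []      δ _              _    = refl
  reverse-actW (g ∷ γ) δ (γ<g ∷ decγ) decδ = begin
    reverse (actL g (actW γ δ))     ≡⟨ reverse-actL g (actW γ δ) decγ′ ⟩
    actAsc g (reverse (actW γ δ))   ≡⟨ cong (actAsc g) IH ⟩
    actAsc g (leftCol G D)          ≡⟨ leftCol-∷ʳ G D (All-reverse⁺ γ<g) ⟨
    leftCol (G ∷ʳ g) D              ≡⟨ cong (λ G′ → leftCol G′ D) (List.unfold-reverse g γ) ⟨
    leftCol (reverse (g ∷ γ)) D     ∎
    where
    open ≡-Reasoning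
    G = reverse γ
    D = reverse δ
    IH = reverse-actW γ δ decγ decδ
    decγ′ : Decreasing (actW γ δ)
    decγ′ = AllPairs-reverse⁻ (subst Increasing (sym IH)
              (leftCol-increasing G D (AllPairs-reverse⁺ decγ) (AllPairs-reverse⁺ decδ)))

  removeOne-↭ : ∀ {y : Fin n} xs → y ∈ xs → xs ↭ y ∷ removeOne y xs
  removeOne-↭ {y} (z ∷ zs) y∈zzs with z ≟ y
  ... | yes z≡y = ↭-reflexive (cong (_∷ zs) z≡y)
  removeOne-↭ (z ∷ zs) (here y≡z)  | no z≢y = ⊥-elim (z≢y (sym y≡z))
  removeOne-↭ (z ∷ zs) (there y∈zs) | no _  = ↭-trans (prep z (removeOne-↭ zs y∈zs)) (swap z _ ↭-refl)

  msDiff-↭ : ∀ ys {xs zs} → xs ↭ ys ++ zs → msDiff xs ys ↭ zs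
  msDiff-↭ []       p = p
  msDiff-↭ (y ∷ ys) {xs} p = msDiff-↭ ys
    (Perm.drop-∷ (↭-trans (↭-sym (removeOne-↭ xs (Perm.∈-resp-↭ (↭-sym p) (here refl)))) p))

  All-removeOne : ∀ {p} {P : Pred (Fin n) p} y xs → All P xs → All P (removeOne y xs)
  All-removeOne y []       []         = []
  All-removeOne y (z ∷ zs) (pz ∷ pzs) with z ≟ y
  ... | yes _ = pzs
  ... | no  _ = pz ∷ All-removeOne y zs pzs

  AllPairs-removeOne : ∀ {r} {R : Rel (Fin n) r} y xs → AllPairs R xs → AllPairs R (removeOne y xs)
  AllPairs-removeOne y []       []         = []
  AllPairs-removeOne y (z ∷ zs) (pz ∷ pzs) with z ≟ y
  ... | yes _ = pzs
  ... | no  _ = All-removeOne y zs pz ∷ AllPairs-removeOne y zs pzs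

  AllPairs-msDiff : ∀ {r} {R : Rel (Fin n) r} xs ys → AllPairs R xs → AllPairs R (msDiff xs ys)
  AllPairs-msDiff xs []       p = p
  AllPairs-msDiff xs (y ∷ ys) p = AllPairs-msDiff (removeOne y xs) ys (AllPairs-removeOne y xs p)

  ≥-decTotalOrder : DecTotalOrder _ _ _
  ≥-decTotalOrder = Flip.decTotalOrder (Fin.≤-decTotalOrder n)

  NonIncreasing : List (Fin n) → Set
  NonIncreasing = AllPairs (flip _≤_)

  msUnion-nonIncreasing : ∀ {xs ys} → NonIncreasing xs → NonIncreasing ys → NonIncreasing (msUnion xs ys)
  msUnion-nonIncreasing xs↘ ys↘ = Sorted.Sorted⇒AllPairs O
      (Sorted.merge⁺ ≥-decTotalOrder (Sorted.AllPairs⇒Sorted O xs↘) (Sorted.AllPairs⇒Sorted O ys↘))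
    where O = DecTotalOrder.totalOrder ≥-decTotalOrder

  ↭-nonIncreasing-≡ : ∀ {xs ys} → NonIncreasing xs → NonIncreasing ys → xs ↭ ys → xs ≡ ys
  ↭-nonIncreasing-≡ xs↘ ys↘ p =
    ≋⇒≡ (Sorted.↗↭↗⇒≋ O (Sorted.AllPairs⇒Sorted O xs↘) (Sorted.AllPairs⇒Sorted O ys↘) (↭⇒↭ₛ p))
    where O = DecTotalOrder.totalOrder ≥-decTotalOrder

  reverse-msDiff : ∀ γ δ → Decreasing γ → Decreasing δ →
                   reverse (msDiff (msUnion γ δ) (actW γ δ)) ≡ rightCol (reverse γ) (reverse δ)
  reverse-msDiff γ δ decγ decδ =
    trans (cong reverse δ′≡) (List.reverse-involutive R)
    where
    G = reverse γ
    D = reverse δ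
    L = leftCol G D
    R = rightCol G D
    γ′ = actW γ δ
    rγ′ : reverse γ′ ≡ L
    rγ′ = reverse-actW γ δ decγ decδ
    ∪↭ : msUnion γ δ ↭ γ′ ++ reverse R
    ∪↭ = begin
      msUnion γ δ         ↭⟨ Perm.merge-↭ _ γ δ ⟩
      γ ++ δ              ↭⟨ Perm.++⁺ (Perm.↭-reverse γ) (Perm.↭-reverse δ) ⟨
      G ++ D              ↭⟨ columns-↭ G D ⟩
      L ++ R              ≡⟨ cong (_++ R) rγ′ ⟨
      reverse γ′ ++ R     ↭⟨ Perm.++⁺ (Perm.↭-reverse γ′) (↭-sym (Perm.↭-reverse R)) ⟩
      γ′ ++ reverse R     ∎
      where open PermutationReasoning
    δ′≡ : msDiff (msUnion γ δ) γ′ ≡ reverse R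
    δ′≡ = ↭-nonIncreasing-≡
      (AllPairs-msDiff _ γ′ (msUnion-nonIncreasing (AllPairs.map ℕ.<⇒≤ decγ) (AllPairs.map ℕ.<⇒≤ decδ)))
      (AllPairs-reverse⁺ (AllPairs.map ℕ.<⇒≤ (rightCol-increasing G D (AllPairs-reverse⁺ decδ))))
      (msDiff-↭ γ′ ∪↭)

  tableau : List (Fin n) × List (Fin n) → List (List (Fin n))
  tableau ([]    , _)     = []
  tableau (a ∷ A , [])    = [ a ] ∷ tableau (A , [])
  tableau (a ∷ A , b ∷ B) = (a ∷ b ∷ []) ∷ tableau (A , B)

  rowIns-< : ∀ {x y : Fin n} ys → x < y → rowIns x (y ∷ ys) ≡ (just y , x ∷ ys)
  rowIns-< {x} {y} _ x<y with x <? y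
  ... | yes _   = refl
  ... | no  x≮y = ⊥-elim (x≮y x<y)

  rowIns-≮ : ∀ {x y : Fin n} ys → ¬ x < y → rowIns x (y ∷ ys) ≡ map₂ (y ∷_) (rowIns x ys)
  rowIns-≮ {x} {y} _ x≮y with x <? y
  ... | yes x<y = ⊥-elim (x≮y x<y)
  ... | no  _   = refl

  tabIns-bump : ∀ {x y : Fin n} {r r′} rs → rowIns x r ≡ (just y , r′) → tabIns x (r ∷ rs) ≡ r′ ∷ tabIns y rs
  tabIns-bump _ eq rewrite eq = refl

  tabIns-settle : ∀ {x : Fin n} {r r′} rs → rowIns x r ≡ (nothing , r′) → tabIns x (r ∷ rs) ≡ r′ ∷ rs
  tabIns-settle _ eq rewrite eq = refl

  tabIns-shift : ∀ {x} A B → Increasing A → All (x <_) A → AscLe A B →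
                 tabIns x (tableau (A , B)) ≡ tableau (x ∷ A , B)
  tabIns-shift []      _       _              _          nil = refl
  tabIns-shift {x} (a ∷ A) []      (a<A ∷ incA) (x<a ∷ _) nil =
    trans (tabIns-bump _ (rowIns-< [] x<a)) (cong ([ x ] ∷_) (tabIns-shift A [] incA a<A nil))
  tabIns-shift {x} (a ∷ A) (b ∷ B) (a<A ∷ incA) (x<a ∷ _) (cons _ A≤B) =
    trans (tabIns-bump _ (rowIns-< [ b ] x<a)) (cong ((x ∷ b ∷ []) ∷_) (tabIns-shift A B incA a<A A≤B))

  tabIns-columns : ∀ {d} G D → Increasing G → Increasing (d ∷ D) →
                   tabIns d (tableau (columns G D)) ≡ tableau (columns G (d ∷ D))
  tabIns-columns []      D _ (d<D ∷ incD) = tabIns-shift D [] incD d<D nil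
  tabIns-columns {d} (g ∷ G) D incG@(g<G ∷ _) (d<D ∷ incD) with d <? g
  ... | yes d<g = tabIns-shift (leftCol (g ∷ G) D) (rightCol (g ∷ G) D)
                    (leftCol-increasing (g ∷ G) D incG incD)
                    (All-leftCol (g ∷ G) D (d<g ∷ All.map (Fin.<-trans d<g) g<G) d<D)
                    (leftCol≤rightCol (g ∷ G) D incG incD)
  tabIns-columns {d} (g ∷ G) [] _ _ | no d≮g =
    trans (tabIns-settle _ (rowIns-≮ [] d≮g))
          (cong (λ p → (g ∷ d ∷ []) ∷ tableau p) (sym (columns-[]ʳ G)))
  tabIns-columns {d} (g ∷ G) (e ∷ D) (_ ∷ incG′) ((d<e ∷ _) ∷ incD) | no d≮g = begin
    tabIns d (tableau (columns (g ∷ G) (e ∷ D)))       ≡⟨ cong (tabIns d ∘ tableau) (columns-≮ G D e≮g) ⟩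
    tabIns d ((g ∷ e ∷ []) ∷ tableau (columns G D))    ≡⟨ tabIns-bump _ (trans (rowIns-≮ [ e ] d≮g)
                                                              (cong (map₂ (g ∷_)) (rowIns-< [] d<e))) ⟩
    (g ∷ d ∷ []) ∷ tabIns e (tableau (columns G D))    ≡⟨ cong ((g ∷ d ∷ []) ∷_) (tabIns-columns G D incG′ incD) ⟩
    (g ∷ d ∷ []) ∷ tableau (columns G (e ∷ D))         ∎
    where
    open ≡-Reasoning
    e≮g : ¬ e < g
    e≮g e<g = d≮g (Fin.<-trans d<e e<g)

  P-from-++ : ∀ T (u v : List (Fin n)) → P-from T (u ++ v) ≡ P-from (P-from T u) v
  P-from-++ T []      v = refl
  P-from-++ T (x ∷ u) v = P-from-++ (tabIns x T) u v

  P-from-columns : ∀ u G D → Increasing G → Increasing (u ʳ++ D) →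
                   P-from (tableau (columns G D)) u ≡ tableau (columns G (u ʳ++ D))
  P-from-columns []      G D _    _   = refl
  P-from-columns (x ∷ u) G D incG inc =
    trans (cong (λ T → P-from T u) (tabIns-columns G D incG (AllPairs-ʳ++⁻ʳ u inc)))
          (P-from-columns u G (x ∷ D) incG inc)

  P-++-columns : ∀ γ δ → Increasing (reverse γ) → Increasing (reverse δ) →
                 P (γ ++ δ) ≡ tableau (columns (reverse γ) (reverse δ))
  P-++-columns γ δ incG incD = begin
    P (γ ++ δ)                                  ≡⟨ P-from-++ [] γ δ ⟩
    P-from (P γ) δ                              ≡⟨ cong (λ T → P-from T δ) (P-from-columns γ [] [] [] incG) ⟩
    P-from (tableau (reverse γ , [])) δ         ≡⟨ cong (λ p → P-from (tableau p) δ) (columns-[]ʳ (reverse γ)) ⟨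
    P-from (tableau (columns (reverse γ) [])) δ ≡⟨ P-from-columns δ (reverse γ) [] incG incD ⟩
    tableau (columns (reverse γ) (reverse δ))   ∎
    where open ≡-Reasoning

  ≡plax-columns : ∀ γ δ γ′ δ′ → Increasing (reverse γ) → Increasing (reverse δ) →
                  reverse γ′ ≡ leftCol (reverse γ) (reverse δ) →
                  reverse δ′ ≡ rightCol (reverse γ) (reverse δ) →
                  (γ ++ δ) ≡plax (γ′ ++ δ′)
  ≡plax-columns γ δ γ′ δ′ incG incD rγ′ rδ′ = begin
    P (γ ++ δ)                                  ≡⟨ P-++-columns γ δ incG incD ⟩
    tableau (columns G D)                       ≡⟨ cong tableau (columns-fixed L R (leftCol≤rightCol G D incG incD)) ⟨
    tableau (columns L R)                       ≡⟨ cong₂ (λ A B → tableau (columns A B)) rγ′ rδ′ ⟨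
    tableau (columns (reverse γ′) (reverse δ′)) ≡⟨ P-++-columns γ′ δ′ incγ′ incδ′ ⟨
    P (γ′ ++ δ′)                                ∎
    where
    open ≡-Reasoning
    G = reverse γ
    D = reverse δ
    L = leftCol G D
    R = rightCol G D
    incγ′ = subst Increasing (sym rγ′) (leftCol-increasing G D incG incD)
    incδ′ = subst Increasing (sym rδ′) (rightCol-increasing G D incD)

proposition12p5 : (n : ℕ) (γ δ : List (Fin n)) → IsColumn γ → IsColumn δ →
    (γ ⊆ actW γ δ)
    × (actW γ δ ≤ᶜ γ)
    × ((actW γ δ ≡ γ ⇔ msDiff (msUnion γ δ) (actW γ δ) ≡ δ)
      × (msDiff (msUnion γ δ) (actW γ δ) ≡ δ ⇔ γ ≤ᶜ δ))
    × (actW γ δ ≤ᶜ msDiff (msUnion γ δ) (actW γ δ))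
    × ((γ ++ δ) ≡plax (actW γ δ ++ msDiff (msUnion γ δ) (actW γ δ)))
proposition12p5 n γ δ colγ colδ =
    (λ x∈γ → AnyP.reverse⁻ (subst (_ ∈_) (sym rγ′) (⊆-leftCol G D (AnyP.reverse⁺ x∈γ))))
  , subst (λ L → AscLe L G) (sym rγ′) (leftCol≤left G D incG incD)
  , ( ⇔-sym (≡⇔reverse≡ rδ′) ⇔-∘ (leftCol≡⇔rightCol≡ G D incD ⇔-∘ ≡⇔reverse≡ rγ′)
    , rightCol≡⇔AscLe G D incG incD ⇔-∘ ≡⇔reverse≡ rδ′ )
  , subst₂ AscLe (sym rγ′) (sym rδ′) (leftCol≤rightCol G D incG incD)
  , ≡plax-columns γ δ γ′ δ′ incG incD rγ′ rδ′
  where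
  decγ = column⇒decreasing colγ
  decδ = column⇒decreasing colδ
  γ′ = actW γ δ
  δ′ = msDiff (msUnion γ δ) γ′
  G = reverse γ
  D = reverse δ
  incG = AllPairs-reverse⁺ decγ
  incD = AllPairs-reverse⁺ decδ
  rγ′ = reverse-actW γ δ decγ decδ
  rδ′ = reverse-msDiff γ δ decγ decδ
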